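{- Let $\mathfrak S$ be a relational signature and let $M$ be a finite set of epimorphisms in $\mathrm{Rel}(\mathfrak S)$ between finite relational structures. Let $X_0\xrightarrow{x_0}X_1\xrightarrow{x_1}\cdots$ be a sequence of morphisms in $\mathrm{Rel}(\mathfrak S)$ with $X_0$ finite such that (i) each $x_n$ is a relative $M$-cell complex, and (ii) for every $f:A\to B$ in $M$, every $n\ge0$ and every $a:A\to X_n$ there exist $m\ge n$ and $b:B\to X_m$ with $b\circ f=x_{m-1}\circ\dots\circ x_n\circ a$. Then the sequence is eventually stationary: $x_n$ is an isomorphism for all sufficiently large $n$.
   Context: A relational signature $\mathfrak S=(S,R)$ has sorts $S$ and relation symbols with arities $r:s_1\times\dots\times s_n$; $\mathrm{Rel}(\mathfrak S)$ is the category of relational structures $X$ (carriers $X_s$, relations $r_X\subseteq X_{s_1}\times\dots\times X_{s_n}$) with sortwise functions preserving relations as morphisms; it is cocomplete. $X$ is finite if all $X_s$, $r_X$ are finite and only finitely many are nonempty. For a class $M$ of morphisms in a cocomplete category, the class of relative $M$-cell complexes is the least class of morphisms containing $M$ and closed under (i) set-indexed coproducts of morphisms, (ii) pushouts (if $f$ is in the class and $f'$ is a pushout of $f$ along any map, then $f'$ is in the class), and (iii) composition of countable sequences (the canonical map $A_0\to\operatorname{colim}_n A_n$ for a sequence $A_0\to A_1\to\cdots$ of maps in the class). -}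

module Defs where

open import Level using (0ℓ)
open import Data.Nat using (ℕ; zero; suc; _+_)
open import Data.Fin using (Fin)
open import Data.List using (List; []; _∷_)
open import Data.List.Membership.Propositional using (_∈_)
open import Data.Unit using (⊤; tt)
open import Data.Product using (Σ; _×_; _,_; proj₁; proj₂)
open import Relation.Binary using (Setoid)
open import Relation.Binary.PropositionalEquality using (_≡_; refl; cong₂; subst; sym)
open import Function using (_∘_)

record Signature : Set₁ where
  field
    Sort  : Set
    Sym   : Set
    arity : Sym → List Sort

FiniteSub : (T : Set) (_~_ : T → T → Set) (P : T → Set) → Set
FiniteSub T _~_ P =
  Σ ℕ λ k → Σ (Fin k → T) λ e →
    (∀ i → P (e i)) ×
    (∀ t → P t → Σ (Fin k) λ i → e i ~ t) ×
    (∀ i j → e i ~ e j → i ≡ j)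

module Rel (𝔖 : Signature) where
  open Signature 𝔖

  Tuple : (Sort → Setoid 0ℓ 0ℓ) → List Sort → Set
  Tuple C []       = ⊤
  Tuple C (s ∷ ss) = Setoid.Carrier (C s) × Tuple C ss

  TupEq : (C : Sort → Setoid 0ℓ 0ℓ) (ss : List Sort) → Tuple C ss → Tuple C ss → Set
  TupEq C []       _        _        = ⊤
  TupEq C (s ∷ ss) (a , as) (b , bs) = Setoid._≈_ (C s) a b × TupEq C ss as bs

  mapT : {C D : Sort → Setoid 0ℓ 0ℓ} →
         ((s : Sort) → Setoid.Carrier (C s) → Setoid.Carrier (D s)) →
         (ss : List Sort) → Tuple C ss → Tuple D ss
  mapT f []       _        = tt
  mapT f (s ∷ ss) (a , as) = f s a , mapT f ss as

  mapT-id : {C : Sort → Setoid 0ℓ 0ℓ} (ss : List Sort) (t : Tuple C ss) →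
            mapT {C} {C} (λ s a → a) ss t ≡ t
  mapT-id {C} []       tt       = refl
  mapT-id {C} (s ∷ ss) (a , as) = cong₂ _,_ refl (mapT-id {C} ss as)

  mapT-∘ : {C D E : Sort → Setoid 0ℓ 0ℓ}
           (g : (s : Sort) → Setoid.Carrier (D s) → Setoid.Carrier (E s))
           (f : (s : Sort) → Setoid.Carrier (C s) → Setoid.Carrier (D s))
           (ss : List Sort) (t : Tuple C ss) →
           mapT {D} {E} g ss (mapT {C} {D} f ss t) ≡ mapT {C} {E} (λ s → g s ∘ f s) ss t
  mapT-∘ {C} {D} {E} g f []       tt       = refl
  mapT-∘ {C} {D} {E} g f (s ∷ ss) (a , as) = cong₂ _,_ refl (mapT-∘ {C} {D} {E} g f ss as)

  -- Relational structures (carriers are setoids, since Agda has no quotients;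
  -- relations respect the setoid equality).
  record Struct : Set₁ where
    field
      car      : Sort → Setoid 0ℓ 0ℓ
      rel      : (r : Sym) → Tuple car (arity r) → Set
      rel-resp : ∀ r {t u} → TupEq car (arity r) t u → rel r t → rel r u

  open Struct public

  Car : Struct → Sort → Set
  Car X s = Setoid.Carrier (car X s)

  Eq : (X : Struct) (s : Sort) → Car X s → Car X s → Set
  Eq X s = Setoid._≈_ (car X s)

  record Hom (X Y : Struct) : Set where
    field
      fun  : (s : Sort) → Car X s → Car Y s
      resp : ∀ s {a b} → Eq X s a b → Eq Y s (fun s a) (fun s b)
      pres : ∀ r t → rel X r t → rel Y r (mapT fun (arity r) t)

  open Hom public

  idH : {X : Struct} → Hom X X
  idH {X} = record
    { fun  = λ s a → a
    ; resp = λ s p → p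
    ; pres = λ r t p → subst (rel X r) (sym (mapT-id {car X} (arity r) t)) p }

  infixr 9 _∘H_
  _∘H_ : {X Y Z : Struct} → Hom Y Z → Hom X Y → Hom X Z
  _∘H_ {X} {Y} {Z} g f = record
    { fun  = λ s → fun g s ∘ fun f s
    ; resp = λ s p → resp g s (resp f s p)
    ; pres = λ r t p → subst (rel Z r) (mapT-∘ {car X} {car Y} {car Z} (fun g) (fun f) (arity r) t)
                              (pres g r (mapT {car X} {car Y} (fun f) (arity r) t) (pres f r t p)) }

  infix 4 _≈H_
  _≈H_ : {X Y : Struct} → Hom X Y → Hom X Y → Set
  _≈H_ {X} {Y} f g = ∀ s (a : Car X s) → Eq Y s (fun f s a) (fun g s a)

  IsEpi : {A B : Struct} → Hom A B → Set₁
  IsEpi {A} {B} f = ∀ (C : Struct) (g h : Hom B C) → g ∘H f ≈H h ∘H f → g ≈H h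

  IsIso : {A B : Struct} → Hom A B → Set
  IsIso {A} {B} f = Σ (Hom B A) λ g → (g ∘H f ≈H idH) × (f ∘H g ≈H idH)

  IsFinite : Struct → Set
  IsFinite X =
    (∀ s → FiniteSub (Car X s) (Eq X s) (λ _ → ⊤)) ×
    (∀ r → FiniteSub (Tuple (car X) (arity r)) (TupEq (car X) (arity r)) (rel X r)) ×
    (Σ (List Sort) λ Ls → ∀ s → Car X s → s ∈ Ls) ×
    (Σ (List Sym) λ Lr → ∀ r t → rel X r t → r ∈ Lr)

  IsCoproduct : {I : Set} (A : I → Struct) (P : Struct) → (∀ i → Hom (A i) P) → Set₁
  IsCoproduct {I} A P ι =
    ∀ (E : Struct) (h : ∀ i → Hom (A i) E) →
      Σ (Hom P E) λ u → (∀ i → u ∘H ι i ≈H h i) ×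
        (∀ (u' : Hom P E) → (∀ i → u' ∘H ι i ≈H h i) → u' ≈H u)

  -- Pushout square   A --f--> B
  --                  g|       |g'
  --                   C --f'-> D      (f' is a pushout of f along g)
  IsPushout : {A B C D : Struct} → Hom A B → Hom A C → Hom C D → Hom B D → Set₁
  IsPushout {A} {B} {C} {D} f g f' g' =
    (g' ∘H f ≈H f' ∘H g) ×
    (∀ (E : Struct) (h : Hom B E) (k : Hom C E) → h ∘H f ≈H k ∘H g →
      Σ (Hom D E) λ u → (u ∘H g' ≈H h) × (u ∘H f' ≈H k) ×
        (∀ (u' : Hom D E) → u' ∘H g' ≈H h → u' ∘H f' ≈H k → u' ≈H u))

  IsSeqColimit : (A : ℕ → Struct) → (∀ n → Hom (A n) (A (suc n))) →
                 (L : Struct) → (∀ n → Hom (A n) L) → Set₁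
  IsSeqColimit A a L c =
    (∀ n → c (suc n) ∘H a n ≈H c n) ×
    (∀ (E : Struct) (h : ∀ n → Hom (A n) E) → (∀ n → h (suc n) ∘H a n ≈H h n) →
      Σ (Hom L E) λ u → (∀ n → u ∘H c n ≈H h n) ×
        (∀ (u' : Hom L E) → (∀ n → u' ∘H c n ≈H h n) → u' ≈H u))

  -- Relative M-cell complexes, M = {m i | i : Fin k}: the least class
  -- containing M closed under set-indexed coproducts, pushouts and
  -- countable compositions.
  data Cell {k : ℕ} (Dom Cod : Fin k → Struct) (m : ∀ i → Hom (Dom i) (Cod i))
       : {A B : Struct} → Hom A B → Set₁ where
    base    : ∀ i → Cell Dom Cod m (m i)
    coprod  : {I : Set} {As Bs : I → Struct} {fs : ∀ i → Hom (As i) (Bs i)} →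
              (∀ i → Cell Dom Cod m (fs i)) →
              {P Q : Struct} {ι : ∀ i → Hom (As i) P} {κ : ∀ i → Hom (Bs i) Q} →
              IsCoproduct As P ι → IsCoproduct Bs Q κ →
              {h : Hom P Q} → (∀ i → h ∘H ι i ≈H κ i ∘H fs i) →
              Cell Dom Cod m h
    pushout : {A B C D : Struct} {f : Hom A B} {g : Hom A C} {f' : Hom C D} {g' : Hom B D} →
              Cell Dom Cod m f → IsPushout f g f' g' → Cell Dom Cod m f'
    seq     : {As : ℕ → Struct} {a : ∀ n → Hom (As n) (As (suc n))} →
              (∀ n → Cell Dom Cod m (a n)) →
              {L : Struct} {c : ∀ n → Hom (As n) L} →
              IsSeqColimit As a L c → Cell Dom Cod m (c 0)

  -- chain X x n j = x_{j+n-1} ∘ ⋯ ∘ x_n : X n → X (j + n)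
  chain : (X : ℕ → Struct) (x : ∀ n → Hom (X n) (X (suc n))) →
          (n j : ℕ) → Hom (X n) (X (j + n))
  chain X x n zero    = idH
  chain X x n (suc j) = x (j + n) ∘H chain X x n j

{-# OPTIONS --safe #-}
-- Each x n is a cell complex of epimorphisms, hence epi, so X n is a quotient of the finite
-- structure X 0: it is determined by the equalities and relation instances among elements of X 0
-- that hold in X n. These facts are not decidable in X n, so we saturate syntactically instead:
-- starting from the diagram of X 0 we keep adding their congruence consequences and the facts
-- forced by some m i along a map Dom i → X 0 that respects the facts collected so far. By
-- hypothesis (ii) each round holds from some later stage on, and as there are finitely many
-- facts the process stops at a set F* holding in all X n with n ≥ N. The quotient X 0 / F* has
-- extensions along every m i, so the cell complexes x n extend X 0 → X 0 / F* to compatible maps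
-- X n → X 0 / F*; for n ≥ N these are inverted by the maps X 0 / F* → X n induced by
-- X 0 → X n, which is epi.
module Submission where

open import Level using (0ℓ)
open import Defs
open import Data.Bool using (Bool; true; false; T)
open import Data.Empty using (⊥-elim)
open import Data.Fin using (Fin)
import Data.Fin.Properties as Fin
open import Data.List using (List; []; _∷_; length; allFin; concatMap; cartesianProductWith; map; _++_)
open import Data.List.Membership.Propositional using (_∈_; lose; find)
open import Data.List.Membership.Propositional.Properties using (∈-allFin; ∈-cartesianProductWith⁺; ∈-concatMap⁺; ∈-map⁺; ∈-++⁺ˡ; ∈-++⁺ʳ)
open import Data.List.Relation.Unary.Any using (here; there; any?; satisfied)
import Data.List.Relation.Unary.All as All
open import Data.Nat using (ℕ; zero; suc; _+_; _≤_; _<_; _⊔_; z≤n; s≤s; _≤′_; ≤′-refl; ≤′-step)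
open import Data.Nat.Properties using (≤-trans; ≤-refl; m≤m⊔n; m≤n⊔m; ≤⇒≤′; +-suc; +-mono-≤; +-mono-≤-<; +-mono-<-≤; <-≤-trans; n≮n; m≤n⇒m≤1+n; m≤m+n; ≤-<-trans)
open import Data.Product using (Σ; ∃; _×_; _,_; proj₁; proj₂)
open import Data.Sum using (_⊎_; inj₁; inj₂; [_,_])
open import Data.Unit using (⊤; tt)
open import Data.Vec as Vec using (Vec; []; _∷_)
open import Data.Vec.Properties using (lookup∘tabulate)
open import Function using (_∘_; id)
open import Relation.Nullary using (Dec; yes; no; ¬_)
open import Relation.Nullary.Decidable using (map′; ¬?; ⌊_⌋; _×-dec_; _⊎-dec_; T?; toWitness; fromWitness)
open import Relation.Unary using (Decidable)
open import Relation.Binary using (Setoid; DecidableEquality)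
open import Relation.Binary.PropositionalEquality as ≡ using (_≡_; refl; cong; cong₂; subst; subst₂)

Eventually : (ℕ → Set) → Set
Eventually P = Σ ℕ λ N → ∀ n → N ≤ n → P n

eventually-from : {P : ℕ → Set} → (∀ {n} → P n → P (suc n)) → ∀ {t} → P t → Eventually P
eventually-from {P} step {t} Pt = t , λ n t≤n → go (≤⇒≤′ t≤n)
  where
    go : ∀ {n} → t ≤′ n → P n
    go ≤′-refl        = Pt
    go (≤′-step t≤′n) = step (go t≤′n)

eventually-× : {P Q : ℕ → Set} → Eventually P → Eventually Q → Eventually (λ n → P n × Q n)
eventually-× (M , P) (N , Q) = M ⊔ N , λ n M⊔N≤n →
  P n (≤-trans (m≤m⊔n M N) M⊔N≤n) , Q n (≤-trans (m≤n⊔m M N) M⊔N≤n)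

Listable : Set → Set
Listable A = Σ (List A) λ xs → ∀ a → a ∈ xs

module _ {A : Set} (listable : Listable A) where
  private
    xs = proj₁ listable
    complete = proj₂ listable

  search : {P : A → Set} → Decidable P → Dec (∃ P)
  search P? = map′ satisfied (λ (a , Pa) → lose (complete a) Pa) (any? P? xs)

  eventually-∀ : {P : A → ℕ → Set} → (∀ a → Eventually (P a)) → Eventually (λ n → ∀ a → P a n)
  eventually-∀ {P} ev = let N , holds = go xs in N , λ n N≤n a → holds n N≤n (complete a)
    where
      go : (ys : List A) → Eventually (λ n → ∀ {a} → a ∈ ys → P a n)
      go []       = 0 , λ _ _ ()
      go (y ∷ ys) =
        let N , holds = eventually-× (ev y) (go ys)
        in N , λ { n N≤n (here refl) → proj₁ (holds n N≤n) ; n N≤n (there a∈) → proj₂ (holds n N≤n) a∈ }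

Listable-Fin : ∀ n → Listable (Fin n)
Listable-Fin n = allFin n , ∈-allFin

Listable-Σ : {A : Set} {B : A → Set} → Listable A → (∀ a → Listable (B a)) → Listable (Σ A B)
Listable-Σ {B = B} (xs , complete) LB =
  concatMap (λ a → map (a ,_) (proj₁ (LB a))) xs ,
  λ (a , b) → ∈-concatMap⁺ (λ a → map (a ,_) (proj₁ (LB a))) (lose (complete a) (∈-map⁺ (a ,_) (proj₂ (LB a) b)))

Listable-Vec : {A : Set} → Listable A → ∀ n → Listable (Vec A n)
Listable-Vec L zero    = [] ∷ [] , λ { [] → here refl }
Listable-Vec L (suc n) =
  cartesianProductWith _∷_ (proj₁ L) (proj₁ (Listable-Vec L n)) ,
  λ { (a ∷ as) → ∈-cartesianProductWith⁺ _∷_ (proj₂ L a) (proj₂ (Listable-Vec L n) as) }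

module Saturation {U : Set} (universe : List U) (step : (U → Bool) → U → Bool)
                  (inflationary : ∀ F {u} → T (F u) → T (step F u)) where

  infix 4 _⊆ᵇ_
  _⊆ᵇ_ : (U → Bool) → (U → Bool) → Set
  F ⊆ᵇ G = ∀ {u} → T (F u) → T (G u)

  Supported : (U → Bool) → Set
  Supported F = ∀ {u} → T (F u) → u ∈ universe

  Saturated : (U → Bool) → Set
  Saturated F = step F ⊆ᵇ F

  private
    bit : Bool → ℕ
    bit true  = 1
    bit false = 0

    bit-mono : ∀ {a b} → (T a → T b) → bit a ≤ bit b
    bit-mono {false}         _ = z≤n
    bit-mono {true} {true}   _ = s≤s z≤n
    bit-mono {true} {false} a⇒b = ⊥-elim (a⇒b tt)

    bit-strict : ∀ {a b} → ¬ T a → T b → bit a < bit b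
    bit-strict {false} {true} _ _ = s≤s z≤n
    bit-strict {true}         ¬a _ = ⊥-elim (¬a tt)

    bit≤1 : ∀ a → bit a ≤ 1
    bit≤1 true  = s≤s z≤n
    bit≤1 false = z≤n

  count : (U → Bool) → List U → ℕ
  count F []       = 0
  count F (u ∷ us) = bit (F u) + count F us

  count-mono : ∀ {F G} → F ⊆ᵇ G → ∀ us → count F us ≤ count G us
  count-mono F⊆G []       = z≤n
  count-mono F⊆G (u ∷ us) = +-mono-≤ (bit-mono F⊆G) (count-mono F⊆G us)

  count-strict : ∀ {F G u us} → F ⊆ᵇ G → u ∈ us → ¬ T (F u) → T (G u) → count F us < count G us
  count-strict {us = _ ∷ us} F⊆G (here refl) ¬Fu Gu = +-mono-<-≤ (bit-strict ¬Fu Gu) (count-mono F⊆G us)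
  count-strict {us = _ ∷ _}  F⊆G (there u∈)  ¬Fu Gu = +-mono-≤-< (bit-mono F⊆G) (count-strict F⊆G u∈ ¬Fu Gu)

  count≤length : ∀ F us → count F us ≤ length us
  count≤length F []       = z≤n
  count≤length F (u ∷ us) = +-mono-≤ (bit≤1 (F u)) (count≤length F us)

  module _ {Inv : (U → Bool) → Set} (preserved : ∀ {F} → Inv F → Inv (step F))
           (supported : ∀ {F} → Inv F → Supported F) where

    -- A step that does not saturate makes one more fact of the finite universe true.
    saturate-within : ∀ slack F → Inv F → length universe ≤ slack + count F universe →
                      Σ (U → Bool) λ F* → Inv F* × F ⊆ᵇ F* × Saturated F*
    saturate-within slack F inv bound with any? (λ u → T? (step F u) ×-dec ¬? (T? (F u))) universe
    ... | no none = F , inv , id , saturated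
      where
        saturated : Saturated F
        saturated {u} stepFu with T? (F u)
        ... | yes Fu = Fu
        ... | no ¬Fu = ⊥-elim (none (lose (supported (preserved inv) stepFu) (stepFu , ¬Fu)))
    ... | yes new with find new
    ...   | u , u∈ , stepFu , ¬Fu with slack
    ...     | zero  = ⊥-elim (n≮n _ (<-≤-trans (≤-<-trans bound grows) (count≤length (step F) universe)))
      where grows = count-strict (inflationary F) u∈ ¬Fu stepFu
    ...     | suc s =
      let F* , inv* , stepF⊆F* , sat = saturate-within s (step F) (preserved inv) bound′
      in F* , inv* , stepF⊆F* ∘ inflationary F , sat
      where
        grows = count-strict (inflationary F) u∈ ¬Fu stepFu
        bound′ = ≤-trans bound (subst (_≤ s + count (step F) universe) (+-suc s (count F universe))
                                      (+-mono-≤ (≤-refl {s}) grows))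

    saturate : ∀ {F} → Inv F → Σ (U → Bool) λ F* → Inv F* × F ⊆ᵇ F* × Saturated F*
    saturate {F} inv = saturate-within (length universe) F inv (m≤m+n _ _)

module Relational (𝔖 : Signature) where
  open Signature 𝔖
  open Rel 𝔖

  IsEpi-∘H : {X Y Z : Struct} {f : Hom X Y} {g : Hom Y Z} → IsEpi f → IsEpi g → IsEpi (g ∘H f)
  IsEpi-∘H {g = g} f-epi g-epi E u u' u∘g∘f≈u'∘g∘f = g-epi E u u' (f-epi E (u ∘H g) (u' ∘H g) u∘g∘f≈u'∘g∘f)

  IsIso-retract : {A B Z : Struct} (f : Hom A B) (hA : Hom A Z) (hB : Hom B Z) (rA : Hom Z A) (rB : Hom Z B) →
                  hB ∘H f ≈H hA → f ∘H rA ≈H rB → rA ∘H hA ≈H idH → rB ∘H hB ≈H idH → IsIso f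
  IsIso-retract {A} {B} f hA hB rA rB hB∘f≈hA f∘rA≈rB rA∘hA≈id rB∘hB≈id =
    rA ∘H hB ,
    (λ s a → Setoid.trans (car A s) (resp rA s (hB∘f≈hA s a)) (rA∘hA≈id s a)) ,
    (λ s b → Setoid.trans (car B s) (f∘rA≈rB s (fun hB s b)) (rB∘hB≈id s b))

  ≈H-unique : {X Y : Struct} (u₀ : Hom X Y) (u u' : Hom X Y) → u ≈H u₀ → u' ≈H u₀ → u ≈H u'
  ≈H-unique {Y = Y} u₀ u u' u≈u₀ u'≈u₀ s a = Setoid.trans (car Y s) (u≈u₀ s a) (Setoid.sym (car Y s) (u'≈u₀ s a))

  coproduct-jointly-epi : {I : Set} {As : I → Struct} {P E : Struct} (ι : ∀ i → Hom (As i) P) →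
                          IsCoproduct As P ι → (u u' : Hom P E) → (∀ i → u ∘H ι i ≈H u' ∘H ι i) → u ≈H u'
  coproduct-jointly-epi {E = E} ι universal u u' agree =
    let u₀ , _ , unique = universal E (λ i → u' ∘H ι i)
    in ≈H-unique u₀ u u' (unique u agree) (unique u' (λ i s a → Setoid.refl (car E s)))

  pushout-jointly-epi : {A B C D E : Struct} (f : Hom A B) (g : Hom A C) (f' : Hom C D) (g' : Hom B D) →
                        IsPushout f g f' g' → (u u' : Hom D E) →
                        u ∘H g' ≈H u' ∘H g' → u ∘H f' ≈H u' ∘H f' → u ≈H u'
  pushout-jointly-epi {E = E} f g f' g' (comm , universal) u u' agree-g' agree-f' =
    let u₀ , _ , _ , unique = universal E (u' ∘H g') (u' ∘H f') (λ s a → resp u' s (comm s a))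
    in ≈H-unique u₀ u u' (unique u agree-g' agree-f')
                         (unique u' (λ s a → Setoid.refl (car E s)) (λ s a → Setoid.refl (car E s)))

  colimit-jointly-epi : {A : ℕ → Struct} {L E : Struct} (a : ∀ n → Hom (A n) (A (suc n))) (c : ∀ n → Hom (A n) L) →
                        IsSeqColimit A a L c → (u u' : Hom L E) → (∀ n → u ∘H c n ≈H u' ∘H c n) → u ≈H u'
  colimit-jointly-epi {E = E} a c (cocone , universal) u u' agree =
    let u₀ , _ , unique = universal E (λ n → u' ∘H c n) (λ n s a → resp u' s (cocone n s a))
    in ≈H-unique u₀ u u' (unique u agree) (unique u' (λ n s a → Setoid.refl (car E s)))

  agree-along : {X Y E : Struct} (u u' : Hom Y E) (p q : Hom X Y) → p ≈H q → u ∘H p ≈H u' ∘H p → u ∘H q ≈H u' ∘H q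
  agree-along {Y = Y} {E} u u' p q p≈q agree s a =
    Setoid.trans (car E s) (resp u s (Setoid.sym (car Y s) (p≈q s a)))
      (Setoid.trans (car E s) (agree s a) (resp u' s (p≈q s a)))

  module CellComplexes {k : ℕ} (Dom Cod : Fin k → Struct) (m : ∀ i → Hom (Dom i) (Cod i)) where

    Cell⇒IsEpi : (∀ i → IsEpi (m i)) → {A B : Struct} {f : Hom A B} → Cell Dom Cod m f → IsEpi f
    Cell⇒IsEpi m-epi (base i) = m-epi i
    Cell⇒IsEpi m-epi (coprod {fs = fs} cells {ι = ι} {κ} _ Q-coprod {h} square) E u u' agree =
      coproduct-jointly-epi κ Q-coprod u u' λ i →
        Cell⇒IsEpi m-epi (cells i) E (u ∘H κ i) (u' ∘H κ i)
          (agree-along u u' (h ∘H ι i) (κ i ∘H fs i) (square i) (λ s a → agree s (fun (ι i) s a)))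
    Cell⇒IsEpi m-epi (pushout {D = D} {f} {g} {f'} {g'} cell square) E u u' agree =
      pushout-jointly-epi f g f' g' square u u'
        (Cell⇒IsEpi m-epi cell E (u ∘H g') (u' ∘H g')
          (agree-along u u' (f' ∘H g) (g' ∘H f) (λ s a → Setoid.sym (car D s) (proj₁ square s a))
            (λ s a → agree s (fun g s a))))
        agree
    Cell⇒IsEpi m-epi (seq {As} {a} cells {L} {c} colimit) E u u' agree =
      colimit-jointly-epi a c colimit u u' agree-at
      where
        agree-at : ∀ n → u ∘H c n ≈H u' ∘H c n
        agree-at zero    = agree
        agree-at (suc n) = Cell⇒IsEpi m-epi (cells n) E (u ∘H c (suc n)) (u' ∘H c (suc n))
          (agree-along u u' (c n) (c (suc n) ∘H a n) (λ s x → Setoid.sym (car L s) (proj₁ colimit n s x)) (agree-at n))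

    Injective : Struct → Set
    Injective Z = ∀ i (a : Hom (Dom i) Z) → Σ (Hom (Cod i) Z) λ b → b ∘H m i ≈H a

    Cell-extend : {Z : Struct} → Injective Z → {A B : Struct} {f : Hom A B} → Cell Dom Cod m f →
                  (g : Hom A Z) → Σ (Hom B Z) λ g' → g' ∘H f ≈H g
    Cell-extend Z-inj (base i) g = Z-inj i g
    Cell-extend {Z} Z-inj (coprod {fs = fs} cells {ι = ι} {κ} P-coprod Q-coprod {h} square) g =
      v , coproduct-jointly-epi ι P-coprod (v ∘H h) g λ i s a →
            Setoid.trans (car Z s) (resp v s (square i s a))
              (Setoid.trans (car Z s) (v∘κ≈ext i s (fun (fs i) s a)) (proj₂ (ext i) s a))
      where
        ext : ∀ i → Σ (Hom _ Z) λ gᵢ → gᵢ ∘H fs i ≈H g ∘H ι i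
        ext i = Cell-extend Z-inj (cells i) (g ∘H ι i)
        v = proj₁ (Q-coprod Z (λ i → proj₁ (ext i)))
        v∘κ≈ext = proj₁ (proj₂ (Q-coprod Z (λ i → proj₁ (ext i))))
    Cell-extend {Z} Z-inj (pushout {g = g₀} cell (_ , universal)) g =
      let e , e∘f≈g∘g₀ = Cell-extend Z-inj cell (g ∘H g₀)
          u , _ , u∘f'≈g , _ = universal Z e g e∘f≈g∘g₀
      in u , u∘f'≈g
    Cell-extend {Z} Z-inj (seq {As} cells (_ , universal)) g =
      let u , u∘c≈h , _ = universal Z h (λ n → proj₂ (Cell-extend Z-inj (cells n) (h n)))
      in u , u∘c≈h 0
      where
        h : ∀ n → Hom (As n) Z
        h zero    = g
        h (suc n) = proj₁ (Cell-extend Z-inj (cells n) (h n))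

  ≡-family : (Sort → Set) → Sort → Setoid 0ℓ 0ℓ
  ≡-family B s = ≡.setoid (B s)

  module _ {C : Sort → Setoid 0ℓ 0ℓ} where

    TupEq-sym : ∀ ss {t u} → TupEq C ss t u → TupEq C ss u t
    TupEq-sym []       _        = tt
    TupEq-sym (s ∷ ss) (a≈b , t≈u) = Setoid.sym (C s) a≈b , TupEq-sym ss t≈u

    TupEq-trans : ∀ ss {t u v} → TupEq C ss t u → TupEq C ss u v → TupEq C ss t v
    TupEq-trans []       _            _            = tt
    TupEq-trans (s ∷ ss) (a≈b , t≈u) (b≈c , u≈v) = Setoid.trans (C s) a≈b b≈c , TupEq-trans ss t≈u u≈v

    lookupT : ∀ {ss s} → Tuple C ss → s ∈ ss → Setoid.Carrier (C s)
    lookupT (a , _) (here refl) = a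
    lookupT (_ , t) (there s∈)  = lookupT t s∈

    tabulateT : (∀ s → Setoid.Carrier (C s)) → ∀ ss → Tuple C ss
    tabulateT f []       = tt
    tabulateT f (s ∷ ss) = f s , tabulateT f ss

    lookupT-tabulateT : ∀ f ss {s} (s∈ : s ∈ ss) → lookupT (tabulateT f ss) s∈ ≡ f s
    lookupT-tabulateT f (s ∷ ss) (here refl) = refl
    lookupT-tabulateT f (_ ∷ ss) (there s∈)  = lookupT-tabulateT f ss s∈

  module _ {C D : Sort → Setoid 0ℓ 0ℓ} where

    mapT-≈ : (f g : ∀ s → Setoid.Carrier (C s) → Setoid.Carrier (D s)) →
             (∀ s a → Setoid._≈_ (D s) (f s a) (g s a)) →
             ∀ ss t → TupEq D ss (mapT {C} {D} f ss t) (mapT {C} {D} g ss t)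
    mapT-≈ f g f≈g []       _       = tt
    mapT-≈ f g f≈g (s ∷ ss) (a , t) = f≈g s a , mapT-≈ f g f≈g ss t

  module _ {B : Sort → Set} where

    Tuple-≟ : (∀ s → DecidableEquality (B s)) → ∀ ss → DecidableEquality (Tuple (≡-family B) ss)
    Tuple-≟ _≟_ []       _       _       = yes refl
    Tuple-≟ _≟_ (s ∷ ss) (a , t) (b , u) =
      map′ (λ (a≡b , t≡u) → cong₂ _,_ a≡b t≡u) (λ { refl → refl , refl })
           (_≟_ s a b ×-dec Tuple-≟ _≟_ ss t u)

    Listable-Tuple : (∀ s → Listable (B s)) → ∀ ss → Listable (Tuple (≡-family B) ss)
    Listable-Tuple L []       = tt ∷ [] , λ { tt → here refl }
    Listable-Tuple L (s ∷ ss) =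
      cartesianProductWith _,_ (proj₁ (L s)) (proj₁ (Listable-Tuple L ss)) ,
      λ (a , t) → ∈-cartesianProductWith⁺ _,_ (proj₂ (L s) a) (proj₂ (Listable-Tuple L ss) t)

  Fins : (Sort → ℕ) → Sort → Setoid 0ℓ 0ℓ
  Fins κ = ≡-family (Fin ∘ κ)

  module Finite (A : Struct) (fin : IsFinite A) where

    size : Sort → ℕ
    size s = proj₁ (proj₁ fin s)

    element : ∀ s → Fin (size s) → Car A s
    element s = proj₁ (proj₂ (proj₁ fin s))

    index : ∀ s → Car A s → Fin (size s)
    index s a = proj₁ (proj₁ (proj₂ (proj₂ (proj₂ (proj₁ fin s)))) a tt)

    element-index : ∀ s a → Eq A s (element s (index s a)) a
    element-index s a = proj₂ (proj₁ (proj₂ (proj₂ (proj₂ (proj₁ fin s)))) a tt)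

    element-injective : ∀ s {i j} → Eq A s (element s i) (element s j) → i ≡ j
    element-injective s = proj₂ (proj₂ (proj₂ (proj₂ (proj₁ fin s)))) _ _

    index-cong : ∀ s {a b} → Eq A s a b → index s a ≡ index s b
    index-cong s {a} {b} a≈b = element-injective s
      (trans (element-index s a) (trans a≈b (sym (element-index s b))))
      where open Setoid (car A s)

    index-element : ∀ s i → index s (element s i) ≡ i
    index-element s i = element-injective s (element-index s (element s i))

    index-injective : ∀ s {a b} → index s a ≡ index s b → Eq A s a b
    index-injective s {a} {b} eq =
      trans (sym (element-index s a)) (trans (reflexive (cong (element s) eq)) (element-index s b))
      where open Setoid (car A s)

    _≈?_ : ∀ {s} (a b : Car A s) → Dec (Eq A s a b)
    _≈?_ {s} a b = map′ (index-injective s) (index-cong s) (index s a Fin.≟ index s b)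

    sorts : List Sort
    sorts = proj₁ (proj₁ (proj₂ (proj₂ fin)))

    sort-∈ : ∀ s → Car A s → s ∈ sorts
    sort-∈ = proj₂ (proj₁ (proj₂ (proj₂ fin)))

    symbols : List Sym
    symbols = proj₁ (proj₂ (proj₂ (proj₂ fin)))

    symbol-∈ : ∀ r {t} → rel A r t → r ∈ symbols
    symbol-∈ r = proj₂ (proj₂ (proj₂ (proj₂ fin))) r _

    entries : Sym → ℕ
    entries r = proj₁ (proj₁ (proj₂ fin) r)

    entry : ∀ r → Fin (entries r) → Tuple (car A) (arity r)
    entry r = proj₁ (proj₂ (proj₁ (proj₂ fin) r))

    entry-rel : ∀ r j → rel A r (entry r j)
    entry-rel r = proj₁ (proj₂ (proj₂ (proj₁ (proj₂ fin) r)))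

    entry-cover : ∀ r t → rel A r t → Σ (Fin (entries r)) λ j → TupEq (car A) (arity r) (entry r j) t
    entry-cover r = proj₁ (proj₂ (proj₂ (proj₂ (proj₁ (proj₂ fin) r))))

    Index : List Sort → Set
    Index = Tuple (Fins size)

    indices : ∀ ss → Tuple (car A) ss → Index ss
    indices = mapT {car A} {Fins size} index

    elements : ∀ ss → Index ss → Tuple (car A) ss
    elements = mapT {Fins size} {car A} element

    elements-indices : ∀ ss t → TupEq (car A) ss (elements ss (indices ss t)) t
    elements-indices []       _       = tt
    elements-indices (s ∷ ss) (a , t) = element-index s a , elements-indices ss t

    indices-cong : ∀ ss {t u} → TupEq (car A) ss t u → indices ss t ≡ indices ss u
    indices-cong []       _           = refl
    indices-cong (s ∷ ss) (a≈b , t≈u) = cong₂ _,_ (index-cong s a≈b) (indices-cong ss t≈u)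

    indices-elements : ∀ ss w → indices ss (elements ss w) ≡ w
    indices-elements []       _       = refl
    indices-elements (s ∷ ss) (i , w) = cong₂ _,_ (index-element s i) (indices-elements ss w)

    indices-injective : ∀ ss {t u} → indices ss t ≡ indices ss u → TupEq (car A) ss t u
    indices-injective ss {t} {u} eq =
      TupEq-trans ss (TupEq-sym ss (elements-indices ss t))
        (subst (λ w → TupEq (car A) ss (elements ss w) u) (≡.sym eq) (elements-indices ss u))

    Listable-Index : ∀ ss → Listable (Index ss)
    Listable-Index = Listable-Tuple (Listable-Fin ∘ size)

    rel? : ∀ r t → Dec (rel A r t)
    rel? r t = map′ (λ (j , eq) → rel-resp A r (indices-injective (arity r) eq) (entry-rel r j))
                    (λ t∈r → let j , j≈t = entry-cover r t t∈r in j , indices-cong (arity r) j≈t)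
                    (search (Listable-Fin (entries r))
                      (λ j → Tuple-≟ (λ s → Fin._≟_) (arity r) (indices (arity r) (entry r j)) (indices (arity r) t)))

  IsEpi⇒surjective : {A B : Struct} → IsFinite A → IsFinite B → (f : Hom A B) → IsEpi f →
                     ∀ s (b : Car B s) → Σ (Car A s) λ a → Eq B s (fun f s a) b
  IsEpi⇒surjective {A} {B} finA finB f f-epi s b =
    let d , fd≡b = toWitness {a? = hit? (B.index s b)} (subst T (f-epi Two all-true in-image agree s b) tt)
    in A.element s d , B.index-injective s fd≡b
    where
      module A = Finite A finA
      module B = Finite B finB

      hit? : ∀ {s} (j : Fin (B.size s)) → Dec (∃ λ d → B.index s (fun f s (A.element s d)) ≡ j)
      hit? j = search (Listable-Fin _) (λ d → B.index _ (fun f _ (A.element _ d)) Fin.≟ j)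

      Two : Struct
      Two = record { car = λ _ → ≡.setoid Bool ; rel = λ _ _ → ⊤ ; rel-resp = λ _ _ _ → tt }

      all-true : Hom B Two
      all-true = record { fun = λ _ _ → true ; resp = λ _ _ → refl ; pres = λ _ _ _ → tt }

      in-image : Hom B Two
      in-image = record
        { fun  = λ s b → ⌊ hit? (B.index s b) ⌋
        ; resp = λ s b≈b′ → cong (⌊_⌋ ∘ hit?) (B.index-cong s b≈b′)
        ; pres = λ _ _ _ → tt }

      agree : all-true ∘H f ≈H in-image ∘H f
      agree s a with hit? (B.index s (fun f s a))
      ... | yes _    = refl
      ... | no ¬hit = ⊥-elim (¬hit (A.index s a , B.index-cong s (resp f s (A.element-index s a))))

  module Presentation (X₀ : Struct) (finX₀ : IsFinite X₀) where
    open Finite X₀ finX₀ public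

    -- Facts name elements of X₀ by their indices, so that there are only finitely many of them.
    infix 4 _≐_
    data Fact : Set where
      _≐_   : ∀ {s} → Fin (size s) → Fin (size s) → Fact
      holds : ∀ r → Index (arity r) → Fact

    Holds : {Y : Struct} → Hom X₀ Y → Fact → Set
    Holds {Y} g (_≐_ {s} a b) = Eq Y s (fun g s (element s a)) (fun g s (element s b))
    Holds {Y} g (holds r u)   = rel Y r (mapT (fun g) (arity r) (elements (arity r) u))

    Holds-∘ : {Y Z : Struct} (h : Hom Y Z) (g : Hom X₀ Y) → ∀ φ → Holds g φ → Holds (h ∘H g) φ
    Holds-∘ h g (_≐_ {s} a b) a≈b = resp h s a≈b
    Holds-∘ {Y} {Z} h g (holds r u) u∈r =
      subst (rel Z r) (mapT-∘ {car X₀} {car Y} {car Z} (fun h) (fun g) (arity r) (elements (arity r) u))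
        (pres h r _ u∈r)

    Holds-cong : {Y : Struct} {g g′ : Hom X₀ Y} → g ≈H g′ → ∀ φ → Holds g φ → Holds g′ φ
    Holds-cong {Y} g≈g′ (_≐_ {s} a b) a≈b = trans (sym (g≈g′ s _)) (trans a≈b (g≈g′ s _))
      where open Setoid (car Y s)
    Holds-cong {Y} {g} {g′} g≈g′ (holds r u) u∈r =
      rel-resp Y r (mapT-≈ {car X₀} {car Y} (fun g) (fun g′) g≈g′ (arity r) (elements (arity r) u)) u∈r

    Related : (Fact → Set) → ∀ ss → Index ss → Index ss → Set
    Related P []       _       _       = ⊤
    Related P (s ∷ ss) (a , u) (b , v) = P (a ≐ b) × Related P ss u v

    Related? : {P : Fact → Set} → (∀ φ → Dec (P φ)) → ∀ ss u v → Dec (Related P ss u v)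
    Related? P? []       _       _       = yes tt
    Related? P? (s ∷ ss) (a , u) (b , v) = P? (a ≐ b) ×-dec Related? P? ss u v

    data Consequence (P : Fact → Set) : Fact → Set where
      ≐-sym      : ∀ {s} {a b : Fin (size s)} → P (a ≐ b) → Consequence P (b ≐ a)
      ≐-trans    : ∀ {s} {a b c : Fin (size s)} → P (a ≐ b) → P (b ≐ c) → Consequence P (a ≐ c)
      holds-resp : ∀ {r u v} → P (holds r u) → Related P (arity r) u v → Consequence P (holds r v)

    consequence? : {P : Fact → Set} → (∀ φ → Dec (P φ)) → ∀ φ → Dec (Consequence P φ)
    consequence? {P} P? (a ≐ c) =
      map′ [ ≐-sym , (λ (b , a≐b , b≐c) → ≐-trans a≐b b≐c) ] rules
        (P? (c ≐ a) ⊎-dec search (Listable-Fin _) (λ b → P? (a ≐ b) ×-dec P? (b ≐ c)))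
      where
        rules : Consequence P (a ≐ c) → P (c ≐ a) ⊎ ∃ λ b → P (a ≐ b) × P (b ≐ c)
        rules (≐-sym c≐a)         = inj₁ c≐a
        rules (≐-trans a≐b b≐c)   = inj₂ (_ , a≐b , b≐c)
    consequence? {P} P? (holds r v) =
      map′ (λ (u , u∈r , u~v) → holds-resp u∈r u~v) (λ { (holds-resp u∈r u~v) → _ , u∈r , u~v })
        (search (Listable-Index (arity r)) (λ u → P? (holds r u) ×-dec Related? P? (arity r) u v))

    Related-mono : {P Q : Fact → Set} → (∀ {φ} → P φ → Q φ) → ∀ ss {u v} → Related P ss u v → Related Q ss u v
    Related-mono P⊆Q []       _           = tt
    Related-mono P⊆Q (s ∷ ss) (a≐b , u~v) = P⊆Q a≐b , Related-mono P⊆Q ss u~v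

    Consequence-mono : {P Q : Fact → Set} → (∀ {φ} → P φ → Q φ) → ∀ {φ} → Consequence P φ → Consequence Q φ
    Consequence-mono P⊆Q (≐-sym a≐b)              = ≐-sym (P⊆Q a≐b)
    Consequence-mono P⊆Q (≐-trans a≐b b≐c)        = ≐-trans (P⊆Q a≐b) (P⊆Q b≐c)
    Consequence-mono P⊆Q (holds-resp {r} u∈r u~v) = holds-resp (P⊆Q u∈r) (Related-mono P⊆Q (arity r) u~v)

    Holds-closed : {Y : Struct} (g : Hom X₀ Y) → ∀ {φ} → Consequence (Holds g) φ → Holds g φ
    Holds-closed {Y} g (≐-sym {s} a≈b)           = Setoid.sym (car Y s) a≈b
    Holds-closed {Y} g (≐-trans {s} a≈b b≈c)     = Setoid.trans (car Y s) a≈b b≈c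
    Holds-closed {Y} g (holds-resp {r} u∈r u~v) = rel-resp Y r (related⇒TupEq (arity r) _ _ u~v) u∈r
      where
        related⇒TupEq : ∀ ss u v → Related (Holds g) ss u v →
                        TupEq (car Y) ss (mapT (fun g) ss (elements ss u)) (mapT (fun g) ss (elements ss v))
        related⇒TupEq []       _       _       _            = tt
        related⇒TupEq (s ∷ ss) (a , u) (b , v) (a≈b , u~v) = a≈b , related⇒TupEq ss u v u~v

    module Candidates (A : Struct) (finA : IsFinite A) where
      private module A = Finite A finA

      -- A map A → X₀ on indices: for every sort of A, the index of the image of each element.
      Candidate : Set
      Candidate = Tuple (≡-family (λ s → Vec (Fin (size s)) (A.size s))) A.sorts

      Listable-Candidate : Listable Candidate
      Listable-Candidate = Listable-Tuple (λ s → Listable-Vec (Listable-Fin (size s)) (A.size s)) A.sorts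

      apply : Candidate → ∀ s → Fin (A.size s) → Fin (size s)
      apply c s d = Vec.lookup (lookupT c (A.sort-∈ s (A.element s d))) d

      candidate : (∀ s → Fin (A.size s) → Fin (size s)) → Candidate
      candidate f = tabulateT (λ s → Vec.tabulate (f s)) A.sorts

      apply-candidate : ∀ f s d → apply (candidate f) s d ≡ f s d
      apply-candidate f s d =
        ≡.trans (cong (λ v → Vec.lookup v d)
                      (lookupT-tabulateT (λ s → Vec.tabulate (f s)) A.sorts (A.sort-∈ s (A.element s d))))
                (lookup∘tabulate (f s) d)

      applyT : Candidate → ∀ ss → A.Index ss → Index ss
      applyT c = mapT {Fins A.size} {Fins size} (apply c)

      Valid : (Fact → Set) → Candidate → Set
      Valid P c = ∀ r → r ∈ A.symbols → ∀ j → P (holds r (applyT c (arity r) (A.indices (arity r) (A.entry r j))))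

      valid? : {P : Fact → Set} → (∀ φ → Dec (P φ)) → ∀ c → Dec (Valid P c)
      valid? P? c = map′ (λ all r r∈ → All.lookup all r∈) (λ valid → All.tabulate (λ {r} → valid r))
                      (All.all? (λ r → Fin.all? (λ j → P? _)) A.symbols)

      Valid⇒rel : ∀ {P c} → Valid P c → ∀ r t → rel A r t → P (holds r (applyT c (arity r) (A.indices (arity r) t)))
      Valid⇒rel {P} {c} valid r t t∈r =
        let j , entry≈t = A.entry-cover r t t∈r
        in subst (λ w → P (holds r (applyT c (arity r) w))) (A.indices-cong (arity r) entry≈t)
             (valid r (A.symbol-∈ r t∈r) j)

      realize : {Y : Struct} (g : Hom X₀ Y) (c : Candidate) → Valid (Holds g) c → Hom A Y
      realize {Y} g c valid = record
        { fun  = λ s y → fun g s (element s (apply c s (A.index s y)))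
        ; resp = λ s y≈y′ → Setoid.reflexive (car Y s)
                               (cong (λ d → fun g s (element s (apply c s d))) (A.index-cong s y≈y′))
        ; pres = λ r t t∈r → subst (rel Y r) (unfold (arity r) t) (Valid⇒rel {Holds g} {c} valid r t t∈r) }
        where
          unfold : ∀ ss t → mapT (fun g) ss (elements ss (applyT c ss (A.indices ss t)))
                              ≡ mapT {car A} {car Y} (λ s y → fun g s (element s (apply c s (A.index s y)))) ss t
          unfold []       _       = refl
          unfold (s ∷ ss) (a , t) = cong (_ ,_) (unfold ss t)

      realize-element : {Y : Struct} (g : Hom X₀ Y) (c : Candidate) (valid : Valid (Holds g) c) →
                        ∀ s d → fun (realize g c valid) s (A.element s d) ≡ fun g s (element s (apply c s d))
      realize-element g c valid s d = cong (λ d′ → fun g s (element s (apply c s d′))) (A.index-element s d)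

      module _ {B : Struct} (f : Hom A B) (c : Candidate) where

        data ForcedBy : Fact → Set where
          ≐-forced     : ∀ {s} {a b : Fin (size s)} (d d′ : Fin (A.size s)) →
                         Eq B s (fun f s (A.element s d)) (fun f s (A.element s d′)) →
                         apply c s d ≡ a → apply c s d′ ≡ b → ForcedBy (a ≐ b)
          holds-forced : ∀ {r u} (w : A.Index (arity r)) → rel B r (mapT (fun f) (arity r) (A.elements (arity r) w)) →
                         applyT c (arity r) w ≡ u → ForcedBy (holds r u)

        forcedBy? : IsFinite B → ∀ φ → Dec (ForcedBy φ)
        forcedBy? finB (_≐_ {s} a b) =
          map′ (λ (d , d′ , fd≈fd′ , ≡a , ≡b) → ≐-forced d d′ fd≈fd′ ≡a ≡b)
               (λ { (≐-forced d d′ fd≈fd′ ≡a ≡b) → d , d′ , fd≈fd′ , ≡a , ≡b })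
               (search (Listable-Fin _) λ d → search (Listable-Fin _) λ d′ →
                  (fun f s (A.element s d) B.≈? fun f s (A.element s d′)) ×-dec
                  (apply c s d Fin.≟ a) ×-dec (apply c s d′ Fin.≟ b))
          where module B = Finite B finB
        forcedBy? finB (holds r u) =
          map′ (λ (w , w∈r , ≡u) → holds-forced w w∈r ≡u) (λ { (holds-forced w w∈r ≡u) → w , w∈r , ≡u })
               (search (A.Listable-Index (arity r)) λ w →
                  B.rel? r (mapT (fun f) (arity r) (A.elements (arity r) w)) ×-dec
                  Tuple-≟ (λ s → Fin._≟_) (arity r) (applyT c (arity r) w) u)
          where module B = Finite B finB

        ForcedBy⇒Holds : {Y : Struct} (b : Hom B Y) (g : Hom X₀ Y) →
                         (∀ s d → Eq Y s (fun b s (fun f s (A.element s d))) (fun g s (element s (apply c s d)))) →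
                         ∀ {φ} → ForcedBy φ → Holds g φ
        ForcedBy⇒Holds {Y} b g agree (≐-forced {s} d d′ fd≈fd′ refl refl) =
          trans (sym (agree s d)) (trans (resp b s fd≈fd′) (agree s d′))
          where open Setoid (car Y s)
        ForcedBy⇒Holds {Y} b g agree (holds-forced {r} w w∈r refl) =
          rel-resp Y r (agreeT (arity r) w) (pres b r _ w∈r)
          where
            agreeT : ∀ ss w → TupEq (car Y) ss (mapT (fun b) ss (mapT (fun f) ss (A.elements ss w)))
                                                (mapT (fun g) ss (elements ss (applyT c ss w)))
            agreeT []       _       = tt
            agreeT (s ∷ ss) (d , w) = agree s d , agreeT ss w

    record IsCongruence (F : Fact → Bool) : Set where
      field
        diagram⊆ : ∀ {φ} → Holds idH φ → T (F φ)
        closed   : ∀ {φ} → Consequence (T ∘ F) φ → T (F φ)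

    module Quotient (F : Fact → Bool) (congruence : IsCongruence F) where
      open IsCongruence congruence

      carrier : Sort → Setoid 0ℓ 0ℓ
      carrier s = record
        { Carrier       = Car X₀ s
        ; _≈_           = λ a b → T (F (index s a ≐ index s b))
        ; isEquivalence = record
          { refl  = diagram⊆ (Setoid.refl (car X₀ s))
          ; sym   = λ a≈b → closed (≐-sym a≈b)
          ; trans = λ a≈b b≈c → closed (≐-trans a≈b b≈c) } }

      -- Tuple carrier ss and Tuple (car X₀) ss have the same elements but are different types.
      indicesᶠ : ∀ ss → Tuple carrier ss → Index ss
      indicesᶠ = mapT {carrier} {Fins size} index

      indicesᶠ-quotient : ∀ ss t → indicesᶠ ss (mapT {car X₀} {carrier} (λ s a → a) ss t) ≡ indices ss t
      indicesᶠ-quotient = mapT-∘ {car X₀} {carrier} {Fins size} index (λ s a → a)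

      TupEq⇒Related : ∀ ss {t u} → TupEq carrier ss t u → Related (T ∘ F) ss (indicesᶠ ss t) (indicesᶠ ss u)
      TupEq⇒Related []       _           = tt
      TupEq⇒Related (s ∷ ss) (a≈b , t≈u) = a≈b , TupEq⇒Related ss t≈u

      X₀/F : Struct
      X₀/F = record
        { car      = carrier
        ; rel      = λ r t → T (F (holds r (indicesᶠ (arity r) t)))
        ; rel-resp = λ r t≈u t∈r → closed (holds-resp t∈r (TupEq⇒Related (arity r) t≈u)) }

      quotient : Hom X₀ X₀/F
      quotient = record
        { fun  = λ s a → a
        ; resp = λ s {a} {b} a≈b → diagram⊆ (trans (element-index s a) (trans a≈b (sym (element-index s b))))
        ; pres = λ r t t∈r → subst (λ w → T (F (holds r w))) (≡.sym (indicesᶠ-quotient (arity r) t))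
                               (diagram⊆ (subst (rel X₀ r) (≡.sym (mapT-id {car X₀} (arity r) _))
                                 (rel-resp X₀ r (TupEq-sym (arity r) (elements-indices (arity r) t)) t∈r))) }
        where open module X₀-setoid {s} = Setoid (car X₀ s)

      Holds-quotient⁺ : ∀ {φ} → T (F φ) → Holds quotient φ
      Holds-quotient⁺ {_≐_ {s} a b} =
        subst₂ (λ a′ b′ → T (F (a′ ≐ b′))) (≡.sym (index-element s a)) (≡.sym (index-element s b))
      Holds-quotient⁺ {holds r u}   = subst (λ u′ → T (F (holds r u′)))
        (≡.sym (≡.trans (indicesᶠ-quotient (arity r) _) (indices-elements (arity r) u)))

      Holds-quotient⁻ : ∀ {φ} → Holds quotient φ → T (F φ)
      Holds-quotient⁻ {_≐_ {s} a b} = subst₂ (λ a′ b′ → T (F (a′ ≐ b′))) (index-element s a) (index-element s b)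
      Holds-quotient⁻ {holds r u}   = subst (λ u′ → T (F (holds r u′)))
        (≡.trans (indicesᶠ-quotient (arity r) _) (indices-elements (arity r) u))

      factor : {Y : Struct} (g : Hom X₀ Y) → (∀ {φ} → T (F φ) → Holds g φ) → Hom X₀/F Y
      factor {Y} g F⊆g = record
        { fun  = fun g
        ; resp = λ s {a} {b} a≈b → Setoid.trans (car Y s) (resp g s (Setoid.sym (car X₀ s) (element-index s a)))
                                     (Setoid.trans (car Y s) (F⊆g a≈b) (resp g s (element-index s b)))
        ; pres = λ r t t∈r → rel-resp Y r (represent (arity r) t) (F⊆g t∈r) }
        where
          represent : ∀ ss t → TupEq (car Y) ss (mapT (fun g) ss (elements ss (indicesᶠ ss t))) (mapT {carrier} (fun g) ss t)
          represent []       _       = tt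
          represent (s ∷ ss) (a , t) = resp g s (element-index s a) , represent ss t

      module _ {A B : Struct} (finA : IsFinite A) (finB : IsFinite B) (f : Hom A B) (f-epi : IsEpi f) where
        private module A = Finite A finA
        open Candidates A finA

        extend-along : (∀ {c} → Valid (T ∘ F) c → ∀ {φ} → ForcedBy f c φ → T (F φ)) →
                       (a : Hom A X₀/F) → Σ (Hom B X₀/F) λ b → b ∘H f ≈H a
        extend-along F-closed a = b , λ s y → key s (pre-eq s (fun f s y))
          where
            module Z {s} = Setoid (carrier s)
            module B {s} = Setoid (car B s)

            c : Candidate
            c = candidate (λ s d → index s (fun a s (A.element s d)))

            a≈c : ∀ s y → Eq X₀/F s (fun a s y) (element s (apply c s (A.index s y)))
            a≈c s y = Z.trans (resp a s (Setoid.sym (car A s) (A.element-index s y)))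
                        (Z.trans (resp quotient s (Setoid.sym (car X₀ s) (element-index s _)))
                                 (Z.reflexive (cong (element s) (≡.sym (apply-candidate _ s (A.index s y))))))

            c-valid : Valid (T ∘ F) c
            c-valid r _ j = Holds-quotient⁻ (rel-resp X₀/F r (a≈cT (arity r) (A.entry r j)) (pres a r _ (A.entry-rel r j)))
              where
                a≈cT : ∀ ss t → TupEq carrier ss (mapT {car A} {carrier} (fun a) ss t)
                                  (mapT {car X₀} {carrier} (λ s z → z) ss (elements ss (applyT c ss (A.indices ss t))))
                a≈cT []       _       = tt
                a≈cT (s ∷ ss) (y , t) = a≈c s y , a≈cT ss t

            key : ∀ s {y y′} → Eq B s (fun f s y) (fun f s y′) → Eq X₀/F s (fun a s y) (fun a s y′)
            key s {y} {y′} fy≈fy′ =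
              Z.trans (a≈c s y) (Z.trans (Holds-quotient⁺ (F-closed c-valid (≐-forced _ _ fe≈fe′ refl refl)))
                                         (Z.sym (a≈c s y′)))
              where
                fe≈fe′ = B.trans (resp f s (A.element-index s y))
                           (B.trans fy≈fy′ (B.sym (resp f s (A.element-index s y′))))

            pre : ∀ s → Car B s → Car A s
            pre s y = proj₁ (IsEpi⇒surjective finA finB f f-epi s y)

            pre-eq : ∀ s y → Eq B s (fun f s (pre s y)) y
            pre-eq s y = proj₂ (IsEpi⇒surjective finA finB f f-epi s y)

            indices-pre : ∀ ss → Tuple (car B) ss → A.Index ss
            indices-pre ss t = A.indices ss (mapT {car B} {car A} pre ss t)

            hit : ∀ ss t → TupEq (car B) ss t (mapT (fun f) ss (A.elements ss (indices-pre ss t)))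
            hit []       _       = tt
            hit (s ∷ ss) (y , t) = B.trans (B.sym (pre-eq s y)) (resp f s (Setoid.sym (car A s) (A.element-index s _))) , hit ss t

            c≈a-pre : ∀ ss t →
                      TupEq carrier ss (mapT {car X₀} {carrier} (λ s z → z) ss (elements ss (applyT c ss (indices-pre ss t))))
                                                (mapT {car B} {carrier} (λ s y → fun a s (pre s y)) ss t)
            c≈a-pre []       _       = tt
            c≈a-pre (s ∷ ss) (y , t) = Z.sym (a≈c s (pre s y)) , c≈a-pre ss t

            b : Hom B X₀/F
            b = record
              { fun  = λ s y → fun a s (pre s y)
              ; resp = λ s {y} {y′} y≈y′ → key s (B.trans (pre-eq s y) (B.trans y≈y′ (B.sym (pre-eq s y′))))
              ; pres = λ r t t∈r → rel-resp X₀/F r (c≈a-pre (arity r) t)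
                                     (Holds-quotient⁺ (F-closed c-valid
                                       (holds-forced (indices-pre (arity r) t) (rel-resp B r (hit (arity r) t) t∈r) refl))) }

  module Stationarity {k : ℕ} (Dom Cod : Fin k → Struct) (m : ∀ i → Hom (Dom i) (Cod i))
                      (m-epi : ∀ i → IsEpi (m i)) (finDom : ∀ i → IsFinite (Dom i)) (finCod : ∀ i → IsFinite (Cod i))
                      (X : ℕ → Struct) (x : ∀ n → Hom (X n) (X (suc n))) (finX₀ : IsFinite (X 0))
                      (cells : ∀ n → Cell Dom Cod m (x n))
                      (extends : ∀ i n (a : Hom (Dom i) (X n)) →
                        Σ ℕ λ j → Σ (Hom (Cod i) (X (j + n))) λ b → b ∘H m i ≈H chain X x n j ∘H a) where
    open CellComplexes Dom Cod m
    open Presentation (X 0) finX₀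
    module Cand (i : Fin k) = Candidates (Dom i) (finDom i)
    module Cod (i : Fin k) = Finite (Cod i) (finCod i)

    ι : ∀ n → Hom (X 0) (X n)
    ι zero    = idH
    ι (suc n) = x n ∘H ι n

    ι-epi : ∀ n → IsEpi (ι n)
    ι-epi zero    _ _ _ agree = agree
    ι-epi (suc n) = IsEpi-∘H {f = ι n} {x n} (ι-epi n) (Cell⇒IsEpi m-epi (cells n))

    chain∘ι : ∀ t j → chain X x t j ∘H ι t ≈H ι (j + t)
    chain∘ι t j s a = Setoid.reflexive (car (X (j + t)) s) (≡-chain j)
      where
        ≡-chain : ∀ j → fun (chain X x t j) s (fun (ι t) s a) ≡ fun (ι (j + t)) s a
        ≡-chain zero    = refl
        ≡-chain (suc j) = cong (fun (x (j + t)) s) (≡-chain j)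

    Realized : (Fact → Bool) → Set
    Realized F = Eventually (λ n → ∀ {φ} → T (F φ) → Holds (ι n) φ)

    Candidate : Set
    Candidate = Σ (Fin k) Cand.Candidate

    Listable-Candidate : Listable Candidate
    Listable-Candidate = Listable-Σ (Listable-Fin k) Cand.Listable-Candidate

    Forced : (Fact → Set) → Fact → Set
    Forced P φ = ∃ λ ((i , c) : Candidate) → Cand.Valid i P c × Cand.ForcedBy i (m i) c φ

    Step : (Fact → Bool) → Fact → Set
    Step F φ = T (F φ) ⊎ Consequence (T ∘ F) φ ⊎ Forced (T ∘ F) φ

    step? : ∀ F φ → Dec (Step F φ)
    step? F φ =
      T? (F φ) ⊎-dec consequence? (T? ∘ F) φ ⊎-dec
      search Listable-Candidate (λ (i , c) → Cand.valid? i (T? ∘ F) c ×-dec Cand.forcedBy? i (m i) c (finCod i) φ)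

    step : (Fact → Bool) → Fact → Bool
    step F φ = ⌊ step? F φ ⌋

    diagram? : ∀ φ → Dec (Holds idH φ)
    diagram? (a ≐ b)     = element _ a ≈? element _ b
    diagram? (holds r u) = rel? r (mapT (λ s a → a) (arity r) (elements (arity r) u))

    diagram : Fact → Bool
    diagram φ = ⌊ diagram? φ ⌋

    -- Relation symbols cannot be enumerated; these are the only ones that facts can ever mention.
    relevant-symbols : List Sym
    relevant-symbols = symbols ++ concatMap Cod.symbols (allFin k)

    universe : List Fact
    universe = concatMap (λ s → cartesianProductWith (_≐_ {s}) (allFin (size s)) (allFin (size s))) sorts
            ++ concatMap (λ r → map (holds r) (proj₁ (Listable-Index (arity r)))) relevant-symbols

    ≐-∈-universe : ∀ {s} (a b : Fin (size s)) → (a ≐ b) ∈ universe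
    ≐-∈-universe {s} a b =
      ∈-++⁺ˡ (∈-concatMap⁺ _ (lose (sort-∈ s (element s a)) (∈-cartesianProductWith⁺ _≐_ (∈-allFin a) (∈-allFin b))))

    holds-∈-universe : ∀ {r} u → r ∈ relevant-symbols → holds r u ∈ universe
    holds-∈-universe {r} u r∈ =
      ∈-++⁺ʳ _ (∈-concatMap⁺ _ (lose r∈ (∈-map⁺ (holds r) (proj₂ (Listable-Index (arity r)) u))))

    OnRelevantSymbols : (Fact → Bool) → Set
    OnRelevantSymbols F = ∀ {r u} → T (F (holds r u)) → r ∈ relevant-symbols

    open Saturation universe step (λ F Fφ → fromWitness (inj₁ Fφ))

    relevant⇒supported : ∀ {F} → OnRelevantSymbols F → Supported F
    relevant⇒supported relevant {a ≐ b}     _   = ≐-∈-universe a b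
    relevant⇒supported relevant {holds r u} u∈r = holds-∈-universe u (relevant u∈r)

    step-relevant : ∀ {F} → OnRelevantSymbols F → OnRelevantSymbols (step F)
    step-relevant {F} relevant u∈r with toWitness u∈r
    ... | inj₁ u∈F                                = relevant u∈F
    ... | inj₂ (inj₁ (holds-resp u∈F _))          = relevant u∈F
    ... | inj₂ (inj₂ ((i , _) , _ , Cand.holds-forced _ w∈r _)) =
      ∈-++⁺ʳ symbols (∈-concatMap⁺ Cod.symbols (lose (∈-allFin i) (Cod.symbol-∈ i _ w∈r)))

    diagram-relevant : OnRelevantSymbols diagram
    diagram-relevant u∈r = ∈-++⁺ˡ (symbol-∈ _ (toWitness u∈r))

    Holds-later : ∀ {n} φ → Holds (ι n) φ → Holds (ι (suc n)) φ
    Holds-later {n} = Holds-∘ (x n) (ι n)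

    diagram-realized : Realized diagram
    diagram-realized = eventually-from (λ holds-n {φ} φ∈F → Holds-later φ (holds-n {φ} φ∈F)) {0}
                         (λ {φ} φ∈F → toWitness {a? = diagram? φ} φ∈F)

    forced-realized : ∀ {F} → Realized F → ∀ ((i , c) : Candidate) →
                      Eventually (λ n → Cand.Valid i (T ∘ F) c → ∀ {φ} → Cand.ForcedBy i (m i) c φ → Holds (ι n) φ)
    forced-realized {F} (N , F-holds) (i , c) with Cand.valid? i (T? ∘ F) c
    ... | no invalid = 0 , λ _ _ valid → ⊥-elim (invalid valid)
    ... | yes valid  =
      eventually-from (λ holds-n valid′ {φ} forced → Holds-later φ (holds-n valid′ {φ} forced)) {j + N}
        (λ _ {φ} forced → Holds-cong (chain∘ι N j) φ (Cand.ForcedBy⇒Holds i (m i) c b (chain X x N j ∘H ι N) agree forced))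
      where
        realizable : Cand.Valid i (Holds (ι N)) c
        realizable r r∈ e = F-holds N ≤-refl (valid r r∈ e)
        a = Cand.realize i (ι N) c realizable
        j = proj₁ (extends i N a)
        b = proj₁ (proj₂ (extends i N a))
        module Xⱼ {s} = Setoid (car (X (j + N)) s)
        agree : ∀ s d → Eq (X (j + N)) s (fun b s (fun (m i) s (Finite.element (Dom i) (finDom i) s d)))
                                         (fun (chain X x N j) s (fun (ι N) s (element s (Cand.apply i c s d))))
        agree s d = Xⱼ.trans (proj₂ (proj₂ (extends i N a)) s _)
                      (Xⱼ.reflexive (cong (fun (chain X x N j) s) (Cand.realize-element i (ι N) c realizable s d)))

    step-realized : ∀ {F} → Realized F → Realized (step F)
    step-realized {F} realized =
      let N , both-hold = eventually-× realized (eventually-∀ Listable-Candidate (forced-realized realized))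
      in N , λ n N≤n φ∈step → derive n (proj₁ (both-hold n N≤n)) (proj₂ (both-hold n N≤n)) (toWitness φ∈step)
      where
        derive : ∀ n → (∀ {φ} → T (F φ) → Holds (ι n) φ) →
                 (∀ ((i , c) : Candidate) → Cand.Valid i (T ∘ F) c → ∀ {φ} → Cand.ForcedBy i (m i) c φ → Holds (ι n) φ) →
                 ∀ {φ} → Step F φ → Holds (ι n) φ
        derive n F-holds _      (inj₁ φ∈F)                         = F-holds φ∈F
        derive n F-holds _      (inj₂ (inj₁ consequence))          = Holds-closed (ι n) (Consequence-mono F-holds consequence)
        derive n _ forced-holds (inj₂ (inj₂ (ic , valid , forced))) = forced-holds ic valid forced

    saturation : Σ (Fact → Bool) λ F* → (OnRelevantSymbols F* × Realized F*) × diagram ⊆ᵇ F* × Saturated F*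
    saturation = saturate (λ (relevant , realized) → step-relevant relevant , step-realized realized)
                          (relevant⇒supported ∘ proj₁) (diagram-relevant , diagram-realized)

    F* : Fact → Bool
    F* = proj₁ saturation

    F*-realized : Realized F*
    F*-realized = proj₂ (proj₁ (proj₂ saturation))

    F*-saturated : Saturated F*
    F*-saturated = proj₂ (proj₂ (proj₂ saturation))

    F*-congruence : IsCongruence F*
    F*-congruence = record
      { diagram⊆ = λ {φ} holds → proj₁ (proj₂ (proj₂ saturation)) (fromWitness {a? = diagram? φ} holds)
      ; closed   = λ consequence → F*-saturated (fromWitness (inj₂ (inj₁ consequence))) }

    open Quotient F* F*-congruence public

    X₀/F*-injective : Injective X₀/F
    X₀/F*-injective i = extend-along (finDom i) (finCod i) (m i) (m-epi i)
                          (λ {c} valid forced → F*-saturated (fromWitness (inj₂ (inj₂ ((i , c) , valid , forced)))))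

    lift : ∀ n → Hom (X n) X₀/F
    lift zero    = quotient
    lift (suc n) = proj₁ (Cell-extend X₀/F*-injective (cells n) (lift n))

    lift-comm : ∀ n → lift (suc n) ∘H x n ≈H lift n
    lift-comm n = proj₂ (Cell-extend X₀/F*-injective (cells n) (lift n))

    lift∘ι : ∀ n → lift n ∘H ι n ≈H quotient
    lift∘ι zero    s a = Setoid.refl (carrier s)
    lift∘ι (suc n) s a = Setoid.trans (carrier s) (lift-comm n s (fun (ι n) s a)) (lift∘ι n s a)

    N : ℕ
    N = proj₁ F*-realized

    retraction : ∀ n → N ≤ n → Hom X₀/F (X n)
    retraction n N≤n = factor (ι n) (proj₂ F*-realized n N≤n)

    retraction∘lift : ∀ n (N≤n : N ≤ n) → retraction n N≤n ∘H lift n ≈H idH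
    retraction∘lift n N≤n = ι-epi n (X n) (retraction n N≤n ∘H lift n) idH
                              (λ s a → resp (retraction n N≤n) s (lift∘ι n s a))

proposition3p24 : (𝔖 : Signature) → let open Rel 𝔖 in
    (k : ℕ) (Dom Cod : Fin k → Struct) (m : ∀ i → Hom (Dom i) (Cod i)) →
    (∀ i → IsEpi (m i)) → (∀ i → IsFinite (Dom i)) → (∀ i → IsFinite (Cod i)) →
    (X : ℕ → Struct) (x : ∀ n → Hom (X n) (X (suc n))) →
    IsFinite (X 0) →
    (∀ n → Cell Dom Cod m (x n)) →
    (∀ i n (a : Hom (Dom i) (X n)) →
      Σ ℕ λ j → Σ (Hom (Cod i) (X (j + n))) λ b → b ∘H m i ≈H chain X x n j ∘H a) →
    Σ ℕ λ N → ∀ n → N ≤ n → IsIso (x n)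
proposition3p24 𝔖 k Dom Cod m m-epi finDom finCod X x finX₀ cells extends =
  N , λ n N≤n →
    IsIso-retract (x n) (lift n) (lift (suc n)) (retraction n N≤n) (retraction (suc n) (m≤n⇒m≤1+n N≤n))
      (lift-comm n) (λ s a → Setoid.refl (car (X (suc n)) s))
      (retraction∘lift n N≤n) (retraction∘lift (suc n) (m≤n⇒m≤1+n N≤n))
  where
    open Rel 𝔖
    open Relational 𝔖
    open Stationarity Dom Cod m m-epi finDom finCod X x finX₀ cells extends
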